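{- Let $\mathbf P=(P,\le)$ be a poset such that its Dedekind–MacNeille completion $\mathbf D(\mathbf P)$ is a modular lattice. Then $\mathbf P$ is strictly modular.
   Context: For $A\subseteq P$, $L(A)=\{x\in P\mid x\le y\ \forall y\in A\}$, $U(A)=\{x\in P\mid x\ge y\ \forall y\in A\}$; write $L(a,b)=L(\{a,b\})$, $L(a,A)=L(\{a\}\cup A)$, $L(A,B)=L(A\cup B)$, $LU(A)=L(U(A))$, and similarly. For $a\in P$, $A\subseteq P$, $a\le A$ means $a\le y$ for all $y\in A$, and $A\le a$ means $y\le a$ for all $y\in A$. The Dedekind–MacNeille completion is $\mathbf D(\mathbf P)=(D(\mathbf P),\subseteq)$ with $D(\mathbf P)=\{A\subseteq P\mid LU(A)=A\}$, a complete lattice with $A\vee B=LU(A\cup B)$, $A\wedge B=A\cap B$. A poset is strictly modular if for all $x,y,z\in P$ and $X,Z\subseteq P$: (1) if $x\le Z$ then $L(U(x,y),Z)=LU(x,L(y,Z))$; (2) if $L(X)\le z$ then $L(U(L(X),y),z)=LU(L(X),L(y,z))$. -}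

module Defs where

open import Data.Product using (_×_)
open import Level using (Level; _⊔_)
open import Relation.Binary.Bundles using (Poset)
open import Relation.Unary using (Pred; _⊆_; _≐_; _∪_; _∩_; ｛_｝)

module PosetNotions {c ℓ₁ ℓ₂ : Level} (𝑷 : Poset c ℓ₁ ℓ₂) where
  open Poset 𝑷 renaming (Carrier to P)

  Subset : Set _
  Subset = Pred P (c ⊔ ℓ₂)

  L : {ℓ : Level} → Pred P ℓ → Pred P (c ⊔ ℓ ⊔ ℓ₂)
  L A x = ∀ y → A y → x ≤ y

  U : {ℓ : Level} → Pred P ℓ → Pred P (c ⊔ ℓ ⊔ ℓ₂)
  U A x = ∀ y → A y → y ≤ x

  LU : {ℓ : Level} → Pred P ℓ → Pred P (c ⊔ ℓ ⊔ ℓ₂)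
  LU A = L (U A)

  pair : P → P → Pred P c
  pair a b = ｛ a ｝ ∪ ｛ b ｝

  _≤ˢ_ : {ℓ : Level} → P → Pred P ℓ → Set _
  a ≤ˢ A = ∀ y → A y → a ≤ y

  _ˢ≤_ : {ℓ : Level} → Pred P ℓ → P → Set _
  A ˢ≤ a = ∀ y → A y → y ≤ a

  -- carrier of the Dedekind–MacNeille completion D(P)
  InD : Subset → Set _
  InD A = LU A ≐ A

  _∨ᴰ_ : Subset → Subset → Subset
  A ∨ᴰ B = LU (A ∪ B)

  _∧ᴰ_ : Subset → Subset → Subset
  A ∧ᴰ B = A ∩ B

  DMModular : Set _
  DMModular = ∀ (A B C : Subset) → InD A → InD B → InD C →
    A ⊆ C → (A ∨ᴰ (B ∧ᴰ C)) ≐ ((A ∨ᴰ B) ∧ᴰ C)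

  StrictlyModular : Set _
  StrictlyModular =
    (∀ (x y : P) (Z : Subset) → x ≤ˢ Z →
       L (U (pair x y) ∪ Z) ≐ LU (｛ x ｝ ∪ L (｛ y ｝ ∪ Z)))
    ×
    (∀ (y z : P) (X : Subset) → L X ˢ≤ z →
       L (U (L X ∪ ｛ y ｝) ∪ ｛ z ｝) ≐ LU (L X ∪ L (pair y z)))

module Submission where

open import Defs
open import Data.Product using (_,_; proj₁; proj₂; map)
open import Data.Sum using ([_,_]; inj₁; inj₂)
open import Level using (Level; _⊔_)
open import Relation.Binary.Bundles using (Poset)
open import Relation.Binary.PropositionalEquality using (refl)
open import Relation.Unary using (Pred; _⊆_; _≐_; _∪_; _∩_; ｛_｝)
open import Relation.Unary.Algebra using (∩-cong; ∪-cong)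
open import Relation.Unary.Properties using (≐-refl; ≐-sym)
open import Relation.Unary.Relation.Binary.Equality using (≐-setoid)

-- Every lower cone L A lies in D(P) (as LUL = L), the meet of L A and L B is
-- L (A ∪ B), the element x is represented by its ideal ↓ x = L ｛ x ｝, and U
-- cannot tell ｛ x ｝ from ↓ x. Rewriting both sides of each strict modularity
-- condition in these terms turns it into the modular law of D(P) for
-- ↓ x ⊆ L Z, respectively for L X ⊆ ↓ z.

module DedekindMacNeille {c ℓ₁ ℓ₂} (𝑷 : Poset c ℓ₁ ℓ₂) where
  open Poset 𝑷 renaming (Carrier to P; refl to ≤-refl)
  open PosetNotions 𝑷
  open import Relation.Binary.Reasoning.Setoid (≐-setoid P (c ⊔ ℓ₂))

  private
    variable
      ℓ ℓ′ : Level
      A B : Pred P ℓ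
      A′ B′ : Pred P ℓ′

  infix 25 ↓_
  ↓_ : P → Subset
  ↓ x = L ｛ x ｝

  L-antitone : A ⊆ B → L B ⊆ L A
  L-antitone A⊆B w∈LB y y∈A = w∈LB y (A⊆B y∈A)

  U-antitone : A ⊆ B → U B ⊆ U A
  U-antitone A⊆B u∈UB y y∈A = u∈UB y (A⊆B y∈A)

  L-cong : A ≐ A′ → L A ≐ L A′
  L-cong (A⊆A′ , A′⊆A) = L-antitone A′⊆A , L-antitone A⊆A′

  U-cong : A ≐ A′ → U A ≐ U A′
  U-cong (A⊆A′ , A′⊆A) = U-antitone A′⊆A , U-antitone A⊆A′

  LU-cong : A ≐ A′ → LU A ≐ LU A′
  LU-cong A≐A′ = L-cong (U-cong A≐A′)

  L-∪ : L (A ∪ B) ≐ L A ∩ L B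
  L-∪ = (λ w∈ → (λ y y∈A → w∈ y (inj₁ y∈A)) , (λ y y∈B → w∈ y (inj₂ y∈B)))
      , (λ (w∈LA , w∈LB) y → [ w∈LA y , w∈LB y ])

  U-∪ : U (A ∪ B) ≐ U A ∩ U B
  U-∪ = (λ u∈ → (λ y y∈A → u∈ y (inj₁ y∈A)) , (λ y y∈B → u∈ y (inj₂ y∈B)))
      , (λ (u∈UA , u∈UB) y → [ u∈UA y , u∈UB y ])

  U-∪-cong : U A ≐ U A′ → U B ≐ U B′ → U (A ∪ B) ≐ U (A′ ∪ B′)
  U-∪-cong (A⊆A′ , A′⊆A) (B⊆B′ , B′⊆B) =
      (λ u∈ → proj₂ U-∪ (map A⊆A′ B⊆B′ (proj₁ U-∪ u∈)))
    , (λ u∈ → proj₂ U-∪ (map A′⊆A B′⊆B (proj₁ U-∪ u∈)))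

  LUL≐L : LU (L A) ≐ L A
  LUL≐L = (λ w∈ a a∈A → w∈ a (λ v v∈LA → v∈LA a a∈A))
        , (λ w∈LA u u∈ → u∈ _ w∈LA)

  U-↓ : ∀ x → U (↓ x) ≐ U ｛ x ｝
  U-↓ x = (λ u∈ → λ { _ refl → u∈ x (λ { _ refl → ≤-refl }) })
        , (λ x≤u v v≤x → trans (v≤x x refl) (x≤u x refl))

  strictModularity₁ : DMModular → ∀ (x y : P) (Z : Subset) → x ≤ˢ Z →
    L (U (pair x y) ∪ Z) ≐ LU (｛ x ｝ ∪ L (｛ y ｝ ∪ Z))
  strictModularity₁ modular x y Z x≤Z = begin
    L (U (pair x y) ∪ Z)          ≈⟨ L-∪ ⟩
    LU (pair x y) ∩ L Z           ≈⟨ ∩-cong (L-cong (U-∪-cong (≐-sym (U-↓ x)) (≐-sym (U-↓ y)))) ≐-refl ⟩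
    (↓ x ∨ᴰ ↓ y) ∧ᴰ L Z           ≈⟨ ≐-sym (modular (↓ x) (↓ y) (L Z) LUL≐L LUL≐L LUL≐L ↓x⊆LZ) ⟩
    ↓ x ∨ᴰ (↓ y ∧ᴰ L Z)           ≈⟨ LU-cong (∪-cong ≐-refl (≐-sym L-∪)) ⟩
    LU (↓ x ∪ L (｛ y ｝ ∪ Z))      ≈⟨ L-cong (U-∪-cong (U-↓ x) ≐-refl) ⟩
    LU (｛ x ｝ ∪ L (｛ y ｝ ∪ Z))  ∎
    where
    ↓x⊆LZ : ↓ x ⊆ L Z
    ↓x⊆LZ w≤x z z∈Z = trans (w≤x x refl) (x≤Z z z∈Z)

  strictModularity₂ : DMModular → ∀ (y z : P) (X : Subset) → L X ˢ≤ z →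
    L (U (L X ∪ ｛ y ｝) ∪ ｛ z ｝) ≐ LU (L X ∪ L (pair y z))
  strictModularity₂ modular y z X LX≤z = begin
    L (U (L X ∪ ｛ y ｝) ∪ ｛ z ｝)  ≈⟨ L-∪ ⟩
    LU (L X ∪ ｛ y ｝) ∩ ↓ z        ≈⟨ ∩-cong (L-cong (U-∪-cong ≐-refl (≐-sym (U-↓ y)))) ≐-refl ⟩
    (L X ∨ᴰ ↓ y) ∧ᴰ ↓ z            ≈⟨ ≐-sym (modular (L X) (↓ y) (↓ z) LUL≐L LUL≐L LUL≐L LX⊆↓z) ⟩
    L X ∨ᴰ (↓ y ∧ᴰ ↓ z)            ≈⟨ LU-cong (∪-cong ≐-refl (≐-sym L-∪)) ⟩
    LU (L X ∪ L (pair y z))        ∎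
    where
    LX⊆↓z : L X ⊆ ↓ z
    LX⊆↓z w∈LX _ refl = LX≤z _ w∈LX

lemma12 : ∀ {c ℓ₁ ℓ₂} (𝑷 : Poset c ℓ₁ ℓ₂) →
    PosetNotions.DMModular 𝑷 → PosetNotions.StrictlyModular 𝑷
lemma12 𝑷 modular = strictModularity₁ modular , strictModularity₂ modular
  where open DedekindMacNeille 𝑷
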